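{- Let $n$ be a positive integer and let $t_m=\frac{m(m+1)}{2}$ for every non-negative integer $m$. Then the set $$ A_n=\left\{(t_s,\ t_{r+1}-t_s-1) : 0\le s\le r\le n-2\right\} $$ is a generating index set of $\mathrm{ST}_{t_{n-1}}$.
   Context: For a non-negative integer $N$, let $T_N=\{(i,j)\in\mathbb{N}^2 : i+j<N\}$, where $\mathbb{N}$ is the set of non-negative integers. A binary Steinhaus triangle of size $N$ is a family $(a_{i,j})_{(i,j)\in T_N}$ of elements of $\mathbb{Z}_2=\{0,1\}$ such that $a_{i,j}\equiv a_{i-1,j}+a_{i-1,j+1}\pmod 2$ for all $(i,j)\in T_N$ with $i\ge1$. The set $\mathrm{ST}_N$ of binary Steinhaus triangles of size $N$ is a vector space over $\mathbb{Z}/2\mathbb{Z}$ (entrywise addition mod 2) of dimension $N$. A subset $A\subseteq T_N$ is a generating index set of $\mathrm{ST}_N$ if the linear map $\pi_A:\mathrm{ST}_N\to\mathbb{Z}_2^{|A|}$, $(a_{i,j})_{(i,j)\in T_N}\mapsto (a_{i,j})_{(i,j)\in A}$, is an isomorphism. -}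

module Defs where

open import Data.Nat using (ℕ; zero; suc; _+_; _*_; _∸_; _≤_; _<_)
open import Data.Nat.DivMod using (_/_)
open import Data.Bool using (Bool; _xor_)
open import Data.Product using (_×_; ∃; ∃-syntax; _,_)
open import Relation.Binary.PropositionalEquality using (_≡_)

t : ℕ → ℕ
t m = (m * suc m) / 2

T : ℕ → ℕ → ℕ → Set
T N i j = i + j < N

-- Z_2 is represented by Bool,
-- addition mod 2 by _xor_.  Entries are given as a total function
-- ℕ → ℕ → Bool; only the entries on T_N are meaningful (values outside
-- T_N are irrelevant junk), and two triangles are identified when they
-- agree on T_N (see _≈ST_).
record ST (N : ℕ) : Set where
  field
    entry : ℕ → ℕ → Bool
    rule  : ∀ i j → suc i + j < N →
            entry (suc i) j ≡ entry i j xor entry i (suc j)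
open ST public

_≈ST_ : ∀ {N} → ST N → ST N → Set
_≈ST_ {N} a b = ∀ i j → T N i j → entry a i j ≡ entry b i j

-- A ⊆ T_N (A given as a predicate on ℕ × ℕ) is a generating index set of
-- ST_N iff the (linear) restriction map π_A : ST_N → Z_2^A is bijective:
--   * A ⊆ T_N,
--   * π_A injective: triangles agreeing on A are equal,
--   * π_A surjective: every assignment of values on A is realised.
record IsGeneratingIndexSet (N : ℕ) (A : ℕ → ℕ → Set) : Set₁ where
  field
    subset     : ∀ i j → A i j → T N i j
    injective  : (a b : ST N) →
                 (∀ i j → A i j → entry a i j ≡ entry b i j) → a ≈ST b
    surjective : (f : ℕ → ℕ → Bool) →
                 ∃[ a ] (∀ i j → A i j → entry {N} a i j ≡ f i j)

-- A_n = {(t_s, t_{r+1} - t_s - 1) : 0 ≤ s ≤ r ≤ n - 2}.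
-- The condition r ≤ n - 2 is written r + 2 ≤ n (so A_1 is empty).
A : ℕ → ℕ → ℕ → Set
A n i j = ∃[ s ] ∃[ r ] (s ≤ r × r + 2 ≤ n × i ≡ t s × j ≡ t (suc r) ∸ t s ∸ 1)

-- A Steinhaus triangle is determined by its top row x, its entry at (i, j) being
-- Σₖ C(i, k) x (j + k) mod 2.  The points of Aₙ with a given r lie on the antidiagonal
-- i + j = t_{r+1} - 1 in rows t₀, …, t_r; once x₀, …, x_{t_r - 1} are fixed they depend only on
-- the r + 1 new entries x_{t_r}, …, x_{t_{r+1} - 1}, through a binomial transform.  So it suffices
-- that a sequence f over ℤ₂ with Δ^{r+1} f = 0 is determined by, and may take any values at,
-- t₀, …, t_r.  This is proved by induction on r = 2ᵏ + d with d < 2ᵏ: such an f has period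
-- 2ᵏ⁺¹, Δ^{2ᵏ} f has degree ≤ d and period 2ᵏ, and since t_{2ᵏ+u} ≡ t_{2ᵏ-1-u} + 2ᵏ (mod 2ᵏ⁺¹)
-- and t_{2ᵏ-1-u} ≡ t_u + 2ᵏ⁻¹ (mod 2ᵏ), the problem splits into the degrees 2ᵏ - 1 and d.

module Submission where

open import Defs
open import Algebra.Bundles using (CommutativeRing)
open import Data.Bool using (Bool; false; _xor_)
open import Data.Bool.Properties
  using (xor-assoc; xor-comm; xor-same; xor-identityʳ; xor-∧-commutativeRing)
open import Data.Empty using (⊥-elim)
open import Data.Nat using (ℕ; zero; suc; _+_; _*_; _∸_; _≤_; _<_; z≤n; s≤s; _≤?_; _<?_)
open import Data.Nat.Properties
open import Data.Nat.DivMod using (_/_; m*n/n≡m)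
open import Data.Nat.Tactic.RingSolver using (solve-∀)
open import Data.Product using (∃-syntax; _×_; _,_; proj₁; proj₂)
open import Data.Sum using (_⊎_; inj₁; inj₂)
open import Function using (const; _∘_)
open import Relation.Binary.PropositionalEquality
open import Relation.Nullary using (yes; no)
open import Algebra.Properties.CommutativeSemigroup
  (CommutativeRing.+-commutativeSemigroup xor-∧-commutativeRing) using (interchange)
open ≡-Reasoning

xor-cancelˡ : ∀ a b → a xor (a xor b) ≡ b
xor-cancelˡ a b = trans (sym (xor-assoc a a b)) (cong (_xor b) (xor-same a))

xor-cancelʳ : ∀ a b → a xor (b xor a) ≡ b
xor-cancelʳ a b = trans (cong (a xor_) (xor-comm b a)) (xor-cancelˡ a b)

xor≡false⇒≡ : ∀ {a b} → a xor b ≡ false → a ≡ b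
xor≡false⇒≡ {a} {b} a⊕b≡0 = begin
  a                ≡⟨ sym (xor-identityʳ a) ⟩
  a xor false      ≡⟨ cong (a xor_) (sym a⊕b≡0) ⟩
  a xor (a xor b)  ≡⟨ xor-cancelˡ a b ⟩
  b                ∎

-- Finite differences over ℤ₂

Δ : (ℕ → Bool) → ℕ → Bool
Δ f j = f j xor f (suc j)

Δ^ : ℕ → (ℕ → Bool) → ℕ → Bool
Δ^ zero    f = f
Δ^ (suc m) f = Δ^ m (Δ f)

-- Equivalently, f j = Σ_{k<m} a k · C(j, k) mod 2 for some a.
record Degree< (m : ℕ) (f : ℕ → Bool) : Set where
  constructor degree<
  field Δ^≗0 : Δ^ m f ≗ const false
open Degree< public

Δ-cong : ∀ {f g} → f ≗ g → Δ f ≗ Δ g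
Δ-cong f≗g j = cong₂ _xor_ (f≗g j) (f≗g (suc j))

Δ^-cong : ∀ m {f g} → f ≗ g → Δ^ m f ≗ Δ^ m g
Δ^-cong zero    f≗g = f≗g
Δ^-cong (suc m) f≗g = Δ^-cong m (Δ-cong f≗g)

Δ^-+ : ∀ a b f → Δ^ (a + b) f ≗ Δ^ b (Δ^ a f)
Δ^-+ zero    b f j = refl
Δ^-+ (suc a) b f j = Δ^-+ a b (Δ f) j

Δ^-vanishing : ∀ m {f} → f ≗ const false → Δ^ m f ≗ const false
Δ^-vanishing zero    f≗0 = f≗0
Δ^-vanishing (suc m) f≗0 = Δ^-vanishing m (Δ-cong f≗0)

Δ^-xor : ∀ m f g → Δ^ m (λ i → f i xor g i) ≗ (λ i → Δ^ m f i xor Δ^ m g i)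
Δ^-xor zero    f g j = refl
Δ^-xor (suc m) f g j =
  trans (Δ^-cong m (λ i → interchange (f i) (g i) (f (suc i)) (g (suc i))) j)
        (Δ^-xor m (Δ f) (Δ g) j)

Δ^-shift : ∀ m f c j → Δ^ m (λ i → f (i + c)) j ≡ Δ^ m f (j + c)
Δ^-shift zero    f c j = refl
Δ^-shift (suc m) f c j = Δ^-shift m (Δ f) c j

Degree<-mono : ∀ {m m' f} → m ≤ m' → Degree< m f → Degree< m' f
Degree<-mono {m} {m'} {f} m≤m' df = degree< λ j → begin
  Δ^ m' f j               ≡⟨ cong (λ n → Δ^ n f j) (sym (m+[n∸m]≡n m≤m')) ⟩
  Δ^ (m + (m' ∸ m)) f j   ≡⟨ Δ^-+ m (m' ∸ m) f j ⟩
  Δ^ (m' ∸ m) (Δ^ m f) j  ≡⟨ Δ^-vanishing (m' ∸ m) (Δ^≗0 df) j ⟩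
  false                   ∎

Degree<-xor : ∀ {m f g} → Degree< m f → Degree< m g → Degree< m (λ i → f i xor g i)
Degree<-xor {m} {f} {g} df dg =
  degree< λ j → trans (Δ^-xor m f g j) (cong₂ _xor_ (Δ^≗0 df j) (Δ^≗0 dg j))

Degree<-shift : ∀ {m f} c → Degree< m f → Degree< m (λ i → f (i + c))
Degree<-shift {m} {f} c df = degree< λ j → trans (Δ^-shift m f c j) (Δ^≗0 df (j + c))

Degree<-Δ^ : ∀ a {m f} → Degree< (a + m) f → Degree< m (Δ^ a f)
Degree<-Δ^ a {m} {f} df = degree< λ j → trans (sym (Δ^-+ a m f j)) (Δ^≗0 df j)

pow2 : ℕ → ℕ
pow2 zero    = 1
pow2 (suc k) = pow2 k + pow2 k

half : ℕ → ℕ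
half zero    = 0
half (suc k) = pow2 k

1≤pow2 : ∀ k → 1 ≤ pow2 k
1≤pow2 zero    = s≤s z≤n
1≤pow2 (suc k) = ≤-trans (1≤pow2 k) (m≤m+n (pow2 k) (pow2 k))

n<pow2 : ∀ n → n < pow2 n
n<pow2 zero    = s≤s z≤n
n<pow2 (suc n) = +-mono-≤ (1≤pow2 n) (n<pow2 n)

half≤pow2 : ∀ k → half k ≤ pow2 k
half≤pow2 zero    = z≤n
half≤pow2 (suc k) = m≤m+n (pow2 k) (pow2 k)

Δ^-pow2 : ∀ k f j → Δ^ (pow2 k) f j ≡ f j xor f (j + pow2 k)
Δ^-pow2 zero    f j = cong (λ i → f j xor f i) (+-comm 1 j)
Δ^-pow2 (suc k) f j = begin
  Δ^ (h + h) f j                                         ≡⟨ Δ^-+ h h f j ⟩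
  Δ^ h (Δ^ h f) j                                        ≡⟨ Δ^-cong h (Δ^-pow2 k f) j ⟩
  Δ^ h (λ i → f i xor f (i + h)) j                       ≡⟨ Δ^-pow2 k _ j ⟩
  (f j xor f (j + h)) xor (f (j + h) xor f (j + h + h))  ≡⟨ xor-assoc (f j) _ _ ⟩
  f j xor (f (j + h) xor (f (j + h) xor f (j + h + h)))  ≡⟨ cong (f j xor_) (xor-cancelˡ (f (j + h)) _) ⟩
  f j xor f (j + h + h)                                  ≡⟨ cong (λ i → f j xor f i) (+-assoc j h h) ⟩
  f j xor f (j + (h + h))                                ∎
  where
  h : ℕ
  h = pow2 k

Degree<⇒periodic : ∀ k {m f} → m ≤ pow2 k → Degree< m f → ∀ j → f (j + pow2 k) ≡ f j
Degree<⇒periodic k {f = f} m≤2ᵏ df j =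
  sym (xor≡false⇒≡ (trans (sym (Δ^-pow2 k f j)) (Δ^≗0 (Degree<-mono m≤2ᵏ df) j)))

periodic-* : ∀ {P} {f : ℕ → Bool} → (∀ j → f (j + P) ≡ f j) → ∀ q j → f (j + q * P) ≡ f j
periodic-* {P} {f} per zero    j = cong f (+-identityʳ j)
periodic-* {P} {f} per (suc q) j = begin
  f (j + (P + q * P))  ≡⟨ cong (λ n → f (j + n)) (+-comm P (q * P)) ⟩
  f (j + (q * P + P))  ≡⟨ cong f (sym (+-assoc j (q * P) P)) ⟩
  f (j + q * P + P)    ≡⟨ per (j + q * P) ⟩
  f (j + q * P)        ≡⟨ periodic-* per q j ⟩
  f j                  ∎

-- binomial z i = Σₖ C(i, k) z k  (mod 2), by Pascal's rule.
binomial : (ℕ → Bool) → ℕ → Bool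
binomial z zero    = z zero
binomial z (suc i) = binomial z i xor binomial (z ∘ suc) i

newton : (ℕ → Bool) → ℕ → Bool
newton f k = Δ^ k f 0

binomial-cong≤ : ∀ i {z z'} → (∀ k → k ≤ i → z k ≡ z' k) → binomial z i ≡ binomial z' i
binomial-cong≤ zero    z≡z' = z≡z' 0 z≤n
binomial-cong≤ (suc i) z≡z' =
  cong₂ _xor_ (binomial-cong≤ i (λ k k≤i → z≡z' k (m≤n⇒m≤1+n k≤i)))
              (binomial-cong≤ i (λ k k≤i → z≡z' (suc k) (s≤s k≤i)))

binomial-vanishing : ∀ {z} → z ≗ const false → binomial z ≗ const false
binomial-vanishing z≗0 zero    = z≗0 0
binomial-vanishing z≗0 (suc i) =
  cong₂ _xor_ (binomial-vanishing z≗0 i) (binomial-vanishing (z≗0 ∘ suc) i)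

Δ-binomial : ∀ z → Δ (binomial z) ≗ binomial (z ∘ suc)
Δ-binomial z i = xor-cancelˡ (binomial z i) _

Δ^-binomial : ∀ m z → Δ^ m (binomial z) ≗ binomial (λ k → z (m + k))
Δ^-binomial zero    z i = refl
Δ^-binomial (suc m) z i = trans (Δ^-cong m (Δ-binomial z) i) (Δ^-binomial m (z ∘ suc) i)

binomial-newton : ∀ f → binomial (newton f) ≗ f
binomial-newton f zero    = refl
binomial-newton f (suc i) =
  trans (cong₂ _xor_ (binomial-newton f i) (binomial-newton (Δ f) i)) (xor-cancelˡ (f i) (f (suc i)))

binomial-injective : ∀ {z} → binomial z ≗ const false → z ≗ const false
binomial-injective {z} bz≗0 k = begin
  z k                            ≡⟨ cong z (sym (+-identityʳ k)) ⟩
  binomial (λ i → z (k + i)) 0   ≡⟨ sym (Δ^-binomial k z 0) ⟩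
  Δ^ k (binomial z) 0            ≡⟨ Δ^-vanishing k bz≗0 0 ⟩
  false                          ∎

binomial-degree : ∀ r {z} → (∀ k → r < k → z k ≡ false) → Degree< (suc r) (binomial z)
binomial-degree r {z} z-high = degree< λ j →
  trans (Δ^-binomial (suc r) z j) (binomial-vanishing (λ k → z-high (suc r + k) (s≤s (m≤m+n r k))) j)

newton-degree : ∀ r {f} → Degree< (suc r) f → ∀ k → r < k → newton f k ≡ false
newton-degree r df k r<k = Δ^≗0 (Degree<-mono r<k df) 0

delay : ℕ → (ℕ → Bool) → ℕ → Bool
delay zero    z k       = z k
delay (suc h) z zero    = false
delay (suc h) z (suc k) = delay h z k

delay-+ : ∀ h z k → delay h z (h + k) ≡ z k
delay-+ zero    z k = refl
delay-+ (suc h) z k = delay-+ h z k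

Δ^-antidifference : ∀ h y → ∃[ x ] Δ^ h x ≗ y
Δ^-antidifference h y = binomial (delay h (newton y)) , λ i → begin
  Δ^ h (binomial (delay h (newton y))) i         ≡⟨ Δ^-binomial h _ i ⟩
  binomial (λ k → delay h (newton y) (h + k)) i  ≡⟨ binomial-cong≤ i (λ k _ → delay-+ h _ k) ⟩
  binomial (newton y) i                          ≡⟨ binomial-newton y i ⟩
  y i                                            ∎

-- Triangular numbers

tri : ℕ → ℕ
tri zero    = 0
tri (suc m) = tri m + suc m

tri-double : ∀ m → tri m + tri m ≡ m * suc m
tri-double zero    = refl
tri-double (suc m) = begin
  (tri m + suc m) + (tri m + suc m)  ≡⟨ regroup (tri m) m ⟩
  (tri m + tri m) + 2 * suc m        ≡⟨ cong (_+ 2 * suc m) (tri-double m) ⟩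
  m * suc m + 2 * suc m              ≡⟨ expand m ⟩
  suc m * suc (suc m)                ∎
  where
  regroup : ∀ a m → (a + suc m) + (a + suc m) ≡ (a + a) + 2 * suc m
  regroup = solve-∀
  expand : ∀ m → m * suc m + 2 * suc m ≡ suc m * suc (suc m)
  expand = solve-∀

double-injective : ∀ {a b} → a + a ≡ b + b → a ≡ b
double-injective {a} {b} a+a≡b+b =
  *-cancelˡ-≡ a b 2 (trans (double a) (trans a+a≡b+b (sym (double b))))
  where
  double : ∀ n → 2 * n ≡ n + n
  double = solve-∀

t≡tri : ∀ m → t m ≡ tri m
t≡tri m = begin
  m * suc m / 2        ≡⟨ cong (_/ 2) (sym (tri-double m)) ⟩
  (tri m + tri m) / 2  ≡⟨ cong (_/ 2) (double (tri m)) ⟩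
  tri m * 2 / 2        ≡⟨ m*n/n≡m (tri m) 2 ⟩
  tri m                ∎
  where
  double : ∀ n → n + n ≡ n * 2
  double = solve-∀

tri-mono : ∀ {a b} → a ≤ b → tri a ≤ tri b
tri-mono {zero}  {b}     _         = z≤n
tri-mono {suc a} {suc b} (s≤s a≤b) = +-mono-≤ (tri-mono a≤b) (s≤s a≤b)

tri-+-odd : ∀ s q → let H = s + suc q in tri (s + suc (q + q)) ≡ tri s + H + q * (H + H)
tri-+-odd s q = double-injective (begin
  tri n + tri n                                  ≡⟨ tri-double n ⟩
  n * suc n                                      ≡⟨ expand s q ⟩
  s * suc s + 2 * H + 2 * X                      ≡⟨ cong (λ a → a + 2 * H + 2 * X) (sym (tri-double s)) ⟩
  (tri s + tri s) + 2 * H + 2 * X                ≡⟨ regroup (tri s) H X ⟩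
  (tri s + H + X) + (tri s + H + X)              ∎)
  where
  n H X : ℕ
  n = s + suc (q + q)
  H = s + suc q
  X = q * (H + H)
  expand : ∀ s q → (s + suc (q + q)) * suc (s + suc (q + q))
                 ≡ s * suc s + 2 * (s + suc q) + 2 * (q * ((s + suc q) + (s + suc q)))
  expand = solve-∀
  regroup : ∀ a b c → (a + a) + 2 * b + 2 * c ≡ (a + b + c) + (a + b + c)
  regroup = solve-∀

even-split : ∀ u s H → u + suc s ≡ H + H →
             (∃[ q ] s ≡ u + suc (q + q) × u + suc q ≡ H) ⊎
             (∃[ q ] u ≡ s + suc (q + q) × s + suc q ≡ H)
even-split zero    s       zero    ()
even-split zero    s       (suc H) e = inj₁ (H , trans (suc-injective e) (+-suc H H) , refl)
even-split (suc u) zero    zero    ()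
even-split (suc u) zero    (suc H) e =
  inj₂ (H , cong suc (suc-injective (trans (+-comm 1 u) (trans (suc-injective e) (+-suc H H)))) , refl)
even-split (suc u) (suc s) zero    ()
even-split (suc u) (suc s) (suc H) e
  with even-split u s H (suc-injective (trans (sym (+-suc u (suc s)))
                                              (trans (suc-injective e) (+-suc H H))))
... | inj₁ (q , s≡ , H≡) = inj₁ (q , cong suc s≡ , cong suc H≡)
... | inj₂ (q , u≡ , H≡) = inj₂ (q , cong suc u≡ , cong suc H≡)

-- Modulo 2ᵏ, the triangular numbers t_s and t_u with u + s + 1 = 2ᵏ differ by 2ᵏ⁻¹.
tri-complement : ∀ k {y : ℕ → Bool} → (∀ j → y (j + pow2 k) ≡ y j) →
                 ∀ u s → u + suc s ≡ pow2 k → y (tri s) ≡ y (tri u + half k)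
tri-complement zero          _   zero    zero    _ = refl
tri-complement zero          _   zero    (suc s) ()
tri-complement zero          _   (suc u) s       e = ⊥-elim (m+1+n≢0 u (suc-injective e))
tri-complement (suc k) {y} per u s e with even-split u s (pow2 k) e
... | inj₁ (q , refl , u+1+q≡h) = begin
  y (tri (u + suc (q + q)))          ≡⟨ cong y (tri-+-odd u q) ⟩
  y (tri u + H + q * (H + H))        ≡⟨ cong (λ a → y (tri u + a + q * (a + a))) u+1+q≡h ⟩
  y (tri u + h + q * (h + h))        ≡⟨ periodic-* per q _ ⟩
  y (tri u + h)                      ∎
  where
  h H : ℕ
  h = pow2 k
  H = u + suc q
... | inj₂ (q , refl , s+1+q≡h) = begin
  y (tri s)                          ≡⟨ sym (periodic-* per (suc q) (tri s)) ⟩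
  y (tri s + suc q * (h + h))        ≡⟨ cong y (regroup (tri s) h q) ⟩
  y (tri s + h + q * (h + h) + h)    ≡⟨ cong (λ a → y (tri s + a + q * (a + a) + h)) (sym s+1+q≡h) ⟩
  y (tri s + H + q * (H + H) + h)    ≡⟨ cong (λ a → y (a + h)) (sym (tri-+-odd s q)) ⟩
  y (tri (s + suc (q + q)) + h)      ∎
  where
  h H : ℕ
  h = pow2 k
  H = s + suc q
  regroup : ∀ a h q → a + suc q * (h + h) ≡ a + h + q * (h + h) + h
  regroup = solve-∀

-- Interpolation at triangular numbers

InterpolationUnique : ℕ → Set
InterpolationUnique r =
  ∀ f → Degree< (suc r) f → (∀ s → s ≤ r → f (tri s) ≡ false) → f ≗ const false

InterpolationExists : ℕ → Set
InterpolationExists r =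
  ∀ (c : ℕ → Bool) → ∃[ f ] Degree< (suc r) f × (∀ s → s ≤ r → f (tri s) ≡ c s)

interpolation-unique-0 : InterpolationUnique 0
interpolation-unique-0 f df f-at zero    = f-at 0 z≤n
interpolation-unique-0 f df f-at (suc j) =
  trans (sym (xor≡false⇒≡ (Δ^≗0 df j))) (interpolation-unique-0 f df f-at j)

interpolation-exists-0 : InterpolationExists 0
interpolation-exists-0 c = const (c 0) , degree< (λ _ → xor-same (c 0)) , λ { zero z≤n → refl }

module _ k {r c} (r<2ᵏ : r < pow2 k) (c≤2ᵏ : c ≤ pow2 k) where

  interpolation-unique-shifted : InterpolationUnique r →
    ∀ f → Degree< (suc r) f → (∀ s → s ≤ r → f (tri s + c) ≡ false) → f ≗ const false
  interpolation-unique-shifted unique f df f-at j = begin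
    f j                       ≡⟨ sym (Degree<⇒periodic k r<2ᵏ df j) ⟩
    f (j + pow2 k)            ≡⟨ cong (λ n → f (j + n)) (sym (m∸n+n≡m c≤2ᵏ)) ⟩
    f (j + (pow2 k ∸ c + c))  ≡⟨ cong f (sym (+-assoc j _ c)) ⟩
    f (j + (pow2 k ∸ c) + c)  ≡⟨ unique (λ i → f (i + c)) (Degree<-shift c df) f-at _ ⟩
    false                     ∎

  interpolation-exists-shifted : InterpolationExists r →
    ∀ (v : ℕ → Bool) → ∃[ f ] Degree< (suc r) f × (∀ s → s ≤ r → f (tri s + c) ≡ v s)
  interpolation-exists-shifted exists v with exists v
  ... | g , dg , g-at = (λ i → g (i + (pow2 k ∸ c))) , Degree<-shift _ dg , λ s s≤r → begin
    g (tri s + c + (pow2 k ∸ c))    ≡⟨ cong g (+-assoc (tri s) c _) ⟩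
    g (tri s + (c + (pow2 k ∸ c)))  ≡⟨ cong (λ n → g (tri s + n)) (m+[n∸m]≡n c≤2ᵏ) ⟩
    g (tri s + pow2 k)              ≡⟨ Degree<⇒periodic k r<2ᵏ dg (tri s) ⟩
    g (tri s)                       ≡⟨ g-at s s≤r ⟩
    v s                             ∎

-- Interpolation up to t_{h+d}, for h = 2ᵏ and d < h, reduces to interpolation up to t_{h-1}
-- and, through Δ^h, up to t_d at the nodes shifted by 2ᵏ⁻¹.
module Doubling (k : ℕ) where

  h p : ℕ
  h = pow2 k
  p = h ∸ 1

  h≡1+p : h ≡ suc p
  h≡1+p = sym (m+[n∸m]≡n (1≤pow2 k))

  p<h : p < h
  p<h = ≤-reflexive (sym h≡1+p)

  <h⇒≤p : ∀ {n} → n < h → n ≤ p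
  <h⇒≤p n<h = ≤-pred (subst (_ <_) h≡1+p n<h)

  p≤h+d : ∀ d → p ≤ h + d
  p≤h+d d = ≤-trans (<⇒≤ p<h) (m≤m+n h d)

  complement-sum : ∀ {u} → u ≤ p → u + suc (p ∸ u) ≡ h
  complement-sum u≤p = trans (+-suc _ _) (trans (cong suc (m+[n∸m]≡n u≤p)) (sym h≡1+p))

  tri-upper : ∀ {u} → u ≤ p → tri (h + u) ≡ tri (p ∸ u) + h + u * (h + h)
  tri-upper {u} u≤p = begin
    tri (h + u)                    ≡⟨ cong (λ a → tri (a + u)) (sym s+1+u≡h) ⟩
    tri (s + suc u + u)            ≡⟨ cong tri (+-assoc s (suc u) u) ⟩
    tri (s + suc (u + u))          ≡⟨ tri-+-odd s u ⟩
    tri s + H + u * (H + H)        ≡⟨ cong (λ a → tri s + a + u * (a + a)) s+1+u≡h ⟩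
    tri s + h + u * (h + h)        ∎
    where
    s H : ℕ
    s = p ∸ u
    H = s + suc u
    s+1+u≡h : s + suc u ≡ h
    s+1+u≡h = trans (+-suc s u) (trans (cong suc (m∸n+n≡m u≤p)) (sym h≡1+p))

  module _ {d} (x : ℕ → Bool) (d<h : d < h) (dx : Degree< (suc (h + d)) x) where

    Δ^h-degree : Degree< (suc d) (Δ^ h x)
    Δ^h-degree = Degree<-Δ^ h (subst (λ m → Degree< m x) (sym (+-suc h d)) dx)

    upper-value : ∀ {u} → u ≤ d → x (tri (h + u)) ≡ x (tri (p ∸ u)) xor Δ^ h x (tri u + half k)
    upper-value {u} u≤d = begin
      x (tri (h + u))                              ≡⟨ cong x (tri-upper u≤p) ⟩
      x (tri s + h + u * (h + h))                  ≡⟨ periodic-* x-periodic u _ ⟩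
      x (tri s + h)                                ≡⟨ sym (xor-cancelˡ (x (tri s)) _) ⟩
      x (tri s) xor (x (tri s) xor x (tri s + h))  ≡⟨ cong (x (tri s) xor_) (sym (Δ^-pow2 k x (tri s))) ⟩
      x (tri s) xor Δ^ h x (tri s)                 ≡⟨ cong (x (tri s) xor_) y-complement ⟩
      x (tri s) xor Δ^ h x (tri u + half k)        ∎
      where
      s : ℕ
      s = p ∸ u
      u≤p : u ≤ p
      u≤p = <h⇒≤p (≤-<-trans u≤d d<h)
      x-periodic : ∀ j → x (j + (h + h)) ≡ x j
      x-periodic = Degree<⇒periodic (suc k) (+-monoʳ-< h d<h) dx
      y-complement : Δ^ h x (tri s) ≡ Δ^ h x (tri u + half k)
      y-complement = tri-complement k (Degree<⇒periodic k d<h Δ^h-degree) u s (complement-sum u≤p)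

  unique-step : ∀ {d} → d < h → InterpolationUnique d → InterpolationUnique p →
                InterpolationUnique (h + d)
  unique-step {d} d<h unique-d unique-p f df f-at =
    unique-p f (subst (λ m → Degree< m f) h≡1+p (degree< Δ^h≗0)) (λ s s≤p → f-at s (lower s≤p))
    where
    lower : ∀ {s} → s ≤ p → s ≤ h + d
    lower s≤p = ≤-trans s≤p (p≤h+d d)
    y-at : ∀ u → u ≤ d → Δ^ h f (tri u + half k) ≡ false
    y-at u u≤d = begin
      false xor y                    ≡⟨ cong (_xor y) (sym (f-at (p ∸ u) (lower (m∸n≤m p u)))) ⟩
      f (tri (p ∸ u)) xor y          ≡⟨ sym (upper-value f d<h df u≤d) ⟩
      f (tri (h + u))                ≡⟨ f-at (h + u) (+-monoʳ-≤ h u≤d) ⟩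
      false                          ∎
      where
      y : Bool
      y = Δ^ h f (tri u + half k)
    Δ^h≗0 : Δ^ h f ≗ const false
    Δ^h≗0 = interpolation-unique-shifted k d<h (half≤pow2 k) unique-d
              (Δ^ h f) (Δ^h-degree f d<h df) y-at

  exists-step : ∀ {d} → d < h → InterpolationExists d → InterpolationExists p →
                InterpolationExists (h + d)
  exists-step {d} d<h exists-d exists-p c
    with interpolation-exists-shifted k d<h (half≤pow2 k) exists-d (λ u → c (p ∸ u) xor c (h + u))
  ... | y , dy , y-at with Δ^-antidifference h y
  ... | x₀ , Δ^x₀≗y with exists-p (λ s → c s xor x₀ (tri s))
  ... | v , dv , v-at = x , dx , x-at
    where
    x : ℕ → Bool
    x i = x₀ i xor v i
    dx₀ : Degree< (suc (h + d)) x₀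
    dx₀ = degree< λ j → begin
      Δ^ (suc (h + d)) x₀ j   ≡⟨ cong (λ m → Δ^ m x₀ j) (sym (+-suc h d)) ⟩
      Δ^ (h + suc d) x₀ j     ≡⟨ Δ^-+ h (suc d) x₀ j ⟩
      Δ^ (suc d) (Δ^ h x₀) j  ≡⟨ Δ^-cong (suc d) Δ^x₀≗y j ⟩
      Δ^ (suc d) y j          ≡⟨ Δ^≗0 dy j ⟩
      false                   ∎
    dx : Degree< (suc (h + d)) x
    dx = Degree<-xor dx₀ (Degree<-mono (s≤s (p≤h+d d)) dv)
    Δ^x≗y : Δ^ h x ≗ y
    Δ^x≗y j = begin
      Δ^ h x j                ≡⟨ Δ^-xor h x₀ v j ⟩
      Δ^ h x₀ j xor Δ^ h v j  ≡⟨ cong₂ _xor_ (Δ^x₀≗y j) (Δ^≗0 (subst (λ m → Degree< m v) (sym h≡1+p) dv) j) ⟩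
      y j xor false           ≡⟨ xor-identityʳ (y j) ⟩
      y j                     ∎
    lower : ∀ s → s ≤ p → x (tri s) ≡ c s
    lower s s≤p = trans (cong (x₀ (tri s) xor_) (v-at s s≤p)) (xor-cancelʳ (x₀ (tri s)) (c s))
    upper : ∀ u → u ≤ d → x (tri (h + u)) ≡ c (h + u)
    upper u u≤d = begin
      x (tri (h + u))                              ≡⟨ upper-value x d<h dx u≤d ⟩
      x (tri (p ∸ u)) xor Δ^ h x (tri u + half k)  ≡⟨ cong₂ _xor_ (lower (p ∸ u) (m∸n≤m p u))
                                                                  (trans (Δ^x≗y _) (y-at u u≤d)) ⟩
      c (p ∸ u) xor (c (p ∸ u) xor c (h + u))      ≡⟨ xor-cancelˡ (c (p ∸ u)) (c (h + u)) ⟩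
      c (h + u)                                    ∎
    x-at : ∀ s → s ≤ h + d → x (tri s) ≡ c s
    x-at s s≤h+d with s ≤? p
    ... | yes s≤p = lower s s≤p
    ... | no  s≰p = subst (λ s → x (tri s) ≡ c s) (m+[n∸m]≡n h≤s) (upper (s ∸ h) s∸h≤d)
      where
      h≤s : h ≤ s
      h≤s = subst (_≤ s) (sym h≡1+p) (≰⇒> s≰p)
      s∸h≤d : s ∸ h ≤ d
      s∸h≤d = subst (s ∸ h ≤_) (m+n∸m≡n h d) (∸-monoˡ-≤ h s≤h+d)

interpolation : ∀ k r → r < pow2 k → InterpolationUnique r × InterpolationExists r
interpolation zero    zero    _         = interpolation-unique-0 , interpolation-exists-0
interpolation zero    (suc r) (s≤s ())
interpolation (suc k) r r<2h with r <? pow2 k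
... | yes r<h = interpolation k r r<h
... | no  r≮h = subst (λ r → InterpolationUnique r × InterpolationExists r) (m+[n∸m]≡n h≤r)
                  (unique-step d<h (proj₁ IH-d) (proj₁ IH-p) , exists-step d<h (proj₂ IH-d) (proj₂ IH-p))
  where
  open Doubling k
  h≤r : h ≤ r
  h≤r = ≮⇒≥ r≮h
  d : ℕ
  d = r ∸ h
  d<h : d < h
  d<h = +-cancelˡ-< h d h (subst (_< h + h) (sym (m+[n∸m]≡n h≤r)) r<2h)
  IH-d : InterpolationUnique d × InterpolationExists d
  IH-d = interpolation k d d<h
  IH-p : InterpolationUnique p × InterpolationExists p
  IH-p = interpolation k p p<h

interpolation-unique : ∀ r → InterpolationUnique r
interpolation-unique r = proj₁ (interpolation r r (n<pow2 r))

interpolation-exists : ∀ r → InterpolationExists r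
interpolation-exists r = proj₂ (interpolation r r (n<pow2 r))

-- Steinhaus triangles and their top rows

steinhaus : (ℕ → Bool) → ℕ → ℕ → Bool
steinhaus x zero    j = x j
steinhaus x (suc i) j = steinhaus x i j xor steinhaus x i (suc j)

steinhaus-ST : ∀ {N} → (ℕ → Bool) → ST N
steinhaus-ST x = record { entry = steinhaus x ; rule = λ _ _ _ → refl }

entry≡steinhaus : ∀ {N} (a : ST N) i j → i + j < N → entry a i j ≡ steinhaus (entry a 0) i j
entry≡steinhaus     a zero    j _   = refl
entry≡steinhaus {N} a (suc i) j i<N = trans (rule a i j i<N)
  (cong₂ _xor_ (entry≡steinhaus a i j (≤-trans (n≤1+n _) i<N))
               (entry≡steinhaus a i (suc j) (subst (_< N) (sym (+-suc i j)) i<N)))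

steinhaus-local : ∀ {M x x'} → (∀ k → k < M → x k ≡ x' k) →
                  ∀ i j → i + j < M → steinhaus x i j ≡ steinhaus x' i j
steinhaus-local     x≡x' zero    j j<M = x≡x' j j<M
steinhaus-local {M} x≡x' (suc i) j i<M =
  cong₂ _xor_ (steinhaus-local x≡x' i j (≤-trans (n≤1+n _) i<M))
              (steinhaus-local x≡x' i (suc j) (subst (_< M) (sym (+-suc i j)) i<M))

steinhaus-xor : ∀ x x' i j →
                steinhaus (λ k → x k xor x' k) i j ≡ steinhaus x i j xor steinhaus x' i j
steinhaus-xor x x' zero    j = refl
steinhaus-xor x x' (suc i) j =
  trans (cong₂ _xor_ (steinhaus-xor x x' i j) (steinhaus-xor x x' i (suc j)))
        (interchange (steinhaus x i j) (steinhaus x' i j) (steinhaus x i (suc j)) (steinhaus x' i (suc j)))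

steinhaus-antidiagonal : ∀ x {i d} → i ≤ d → steinhaus x i (d ∸ i) ≡ binomial (λ k → x (d ∸ k)) i
steinhaus-antidiagonal x {zero}          _         = refl
steinhaus-antidiagonal x {suc i} {suc d} (s≤s i≤d) = begin
  steinhaus x i (d ∸ i) xor steinhaus x i (suc (d ∸ i))  ≡⟨ xor-comm (steinhaus x i (d ∸ i)) _ ⟩
  steinhaus x i (suc (d ∸ i)) xor steinhaus x i (d ∸ i)  ≡⟨ cong₂ _xor_ right left ⟩
  binomial (λ k → x (suc d ∸ k)) (suc i)                 ∎
  where
  right : steinhaus x i (suc (d ∸ i)) ≡ binomial (λ k → x (suc d ∸ k)) i
  right = trans (cong (steinhaus x i) (sym (+-∸-assoc 1 i≤d))) (steinhaus-antidiagonal x (m≤n⇒m≤1+n i≤d))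
  left : steinhaus x i (d ∸ i) ≡ binomial (λ k → x (d ∸ k)) i
  left = steinhaus-antidiagonal x i≤d

-- diag r = t_{r+1} - 1; the points of Aₙ with this r are (t_s, diag r - t_s) for s ≤ r.
diag : ℕ → ℕ
diag r = tri r + r

tri≤diag : ∀ {s r} → s ≤ r → tri s ≤ diag r
tri≤diag {s} {r} s≤r = ≤-trans (tri-mono s≤r) (m≤m+n (tri r) r)

block-point< : ∀ {s r} → s ≤ r → tri s + (diag r ∸ tri s) < tri (suc r)
block-point< {s} {r} s≤r =
  subst (_< tri (suc r)) (sym (m+[n∸m]≡n (tri≤diag s≤r))) (≤-reflexive (sym (+-suc (tri r) r)))

diag∸<tri : ∀ {r k} → r < k → k ≤ diag r → diag r ∸ k < tri r
diag∸<tri {r} {k} r<k k≤diag = subst (diag r ∸ k <_) (m+n∸n≡m (tri r) r) (∸-monoʳ-< r<k k≤diag)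

r<diag∸ : ∀ {r j} → j < tri r → r < diag r ∸ j
r<diag∸ {r} {j} j<tri = subst (_< diag r ∸ j) (m+n∸m≡n (tri r) r) (∸-monoʳ-< j<tri (m≤m+n (tri r) r))

blockEntry : (ℕ → Bool) → ℕ → ℕ → Bool
blockEntry x r s = steinhaus x (tri s) (diag r ∸ tri s)

window : ℕ → (ℕ → Bool) → ℕ → Bool
window r x k with k ≤? r
... | yes _ = x (diag r ∸ k)
... | no  _ = false

window-≤ : ∀ r x {k} → k ≤ r → window r x k ≡ x (diag r ∸ k)
window-≤ r x {k} k≤r with k ≤? r
... | yes _   = refl
... | no  k≰r = ⊥-elim (k≰r k≤r)

window-> : ∀ r x k → r < k → window r x k ≡ false
window-> r x k r<k with k ≤? r
... | yes k≤r = ⊥-elim (<⇒≱ r<k k≤r)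
... | no  _   = refl

blockEntry-window : ∀ {r x} → (∀ j → j < tri r → x j ≡ false) →
                    ∀ {s} → s ≤ r → blockEntry x r s ≡ binomial (window r x) (tri s)
blockEntry-window {r} {x} x-low {s} s≤r =
  trans (steinhaus-antidiagonal x (tri≤diag s≤r)) (binomial-cong≤ (tri s) agree)
  where
  agree : ∀ k → k ≤ tri s → x (diag r ∸ k) ≡ window r x k
  agree k k≤tri with r <? k
  ... | no  r≮k = sym (window-≤ r x (≮⇒≥ r≮k))
  ... | yes r<k = trans (x-low _ (diag∸<tri r<k (≤-trans k≤tri (tri≤diag s≤r))))
                        (sym (window-> r x k r<k))

block-vanishing : ∀ r x → (∀ j → j < tri r → x j ≡ false) →
                  (∀ s → s ≤ r → blockEntry x r s ≡ false) →
                  ∀ j → j < tri (suc r) → x j ≡ false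
block-vanishing r x x-low block≡0 j j<tri with j <? tri r
... | yes j<tri' = x-low j j<tri'
... | no  j≮tri' = begin
  x j                        ≡⟨ cong x (sym (m∸[m∸n]≡n j≤diag)) ⟩
  x (diag r ∸ (diag r ∸ j))  ≡⟨ sym (window-≤ r x k≤r) ⟩
  window r x (diag r ∸ j)    ≡⟨ binomial-injective window≗0 (diag r ∸ j) ⟩
  false                      ∎
  where
  j≤diag : j ≤ diag r
  j≤diag = ≤-pred (subst (j <_) (+-suc (tri r) r) j<tri)
  k≤r : diag r ∸ j ≤ r
  k≤r = subst (diag r ∸ j ≤_) (m+n∸m≡n (tri r) r) (∸-monoʳ-≤ (diag r) (≮⇒≥ j≮tri'))
  window≗0 : binomial (window r x) ≗ const false
  window≗0 = interpolation-unique r (binomial (window r x)) (binomial-degree r (window-> r x))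
               (λ s s≤r → trans (sym (blockEntry-window x-low s≤r)) (block≡0 s s≤r))

rows-vanishing : ∀ m x → (∀ r → r < m → ∀ s → s ≤ r → blockEntry x r s ≡ false) →
                 ∀ j → j < tri m → x j ≡ false
rows-vanishing zero    x _       j ()
rows-vanishing (suc m) x block≡0 =
  block-vanishing m x (rows-vanishing m x (λ r r<m → block≡0 r (m<n⇒m<1+n r<m))) (block≡0 m ≤-refl)

-- The correction δ lists the Newton coefficients of an interpolant backwards from diag r;
-- as the interpolant has degree ≤ r, δ vanishes below t_r.
block-extension : ∀ r x (c : ℕ → Bool) →
  ∃[ x' ] (∀ j → j < tri r → x' j ≡ x j) × (∀ s → s ≤ r → blockEntry x' r s ≡ c s)
block-extension r x c with interpolation-exists r (λ s → c s xor blockEntry x r s)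
... | f , df , f-at = x' , unchanged , realised
  where
  δ x' : ℕ → Bool
  δ j = newton f (diag r ∸ j)
  x' j = x j xor δ j
  unchanged : ∀ j → j < tri r → x' j ≡ x j
  unchanged j j<tri =
    trans (cong (x j xor_) (newton-degree r df _ (r<diag∸ j<tri))) (xor-identityʳ (x j))
  δ-block : ∀ {s} → s ≤ r → blockEntry δ r s ≡ f (tri s)
  δ-block {s} s≤r = begin
    blockEntry δ r s                                           ≡⟨ steinhaus-antidiagonal δ (tri≤diag s≤r) ⟩
    binomial (λ k → newton f (diag r ∸ (diag r ∸ k))) (tri s)  ≡⟨ binomial-cong≤ (tri s) reverse ⟩
    binomial (newton f) (tri s)                                ≡⟨ binomial-newton f (tri s) ⟩
    f (tri s)                                                  ∎
    where
    reverse : ∀ k → k ≤ tri s → newton f (diag r ∸ (diag r ∸ k)) ≡ newton f k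
    reverse k k≤tri = cong (newton f) (m∸[m∸n]≡n (≤-trans k≤tri (tri≤diag s≤r)))
  realised : ∀ s → s ≤ r → blockEntry x' r s ≡ c s
  realised s s≤r = begin
    blockEntry x' r s       ≡⟨ steinhaus-xor x δ (tri s) _ ⟩
    e xor blockEntry δ r s  ≡⟨ cong (e xor_) (trans (δ-block s≤r) (f-at s s≤r)) ⟩
    e xor (c s xor e)       ≡⟨ xor-cancelʳ e (c s) ⟩
    c s                     ∎
    where
    e : Bool
    e = blockEntry x r s

rows-realising : ∀ m (g : ℕ → ℕ → Bool) → ∃[ x ]
  (∀ r → r < m → ∀ s → s ≤ r → blockEntry x r s ≡ g (tri s) (diag r ∸ tri s))
rows-realising zero    g = const false , λ _ ()
rows-realising (suc m) g with rows-realising m g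
... | x , x-at with block-extension m x (λ s → g (tri s) (diag m ∸ tri s))
... | x' , unchanged , realised = x' , x'-at
  where
  x'-at : ∀ r → r < suc m → ∀ s → s ≤ r → blockEntry x' r s ≡ g (tri s) (diag r ∸ tri s)
  x'-at r r<1+m s s≤r with m<1+n⇒m<n∨m≡n r<1+m
  ... | inj₂ refl = realised s s≤r
  ... | inj₁ r<m  = trans (steinhaus-local unchanged-below (tri s) (diag r ∸ tri s) (block-point< s≤r))
                          (x-at r r<m s s≤r)
    where
    unchanged-below : ∀ j → j < tri (suc r) → x' j ≡ x j
    unchanged-below j j<tri = unchanged j (<-≤-trans j<tri (tri-mono r<m))

t-diag : ∀ s r → t (suc r) ∸ t s ∸ 1 ≡ diag r ∸ tri s
t-diag s r = begin
  t (suc r) ∸ t s ∸ 1        ≡⟨ cong₂ (λ a b → a ∸ b ∸ 1) (t≡tri (suc r)) (t≡tri s) ⟩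
  tri (suc r) ∸ tri s ∸ 1    ≡⟨ ∸-+-assoc (tri (suc r)) (tri s) 1 ⟩
  tri (suc r) ∸ (tri s + 1)  ≡⟨ cong (tri (suc r) ∸_) (+-comm (tri s) 1) ⟩
  tri (suc r) ∸ (1 + tri s)  ≡⟨ sym (∸-+-assoc (tri (suc r)) 1 (tri s)) ⟩
  tri (suc r) ∸ 1 ∸ tri s    ≡⟨ cong (λ a → a ∸ 1 ∸ tri s) (+-suc (tri r) r) ⟩
  diag r ∸ tri s             ∎

A⇒block : ∀ {m i j} → A (suc m) i j → ∃[ s ] ∃[ r ] s ≤ r × r < m × i ≡ tri s × j ≡ diag r ∸ tri s
A⇒block {m} (s , r , s≤r , r+2≤1+m , i≡ , j≡) =
  s , r , s≤r , ≤-pred (subst (_≤ suc m) (+-comm r 2) r+2≤1+m) , trans i≡ (t≡tri s) , trans j≡ (t-diag s r)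

block⇒A : ∀ {m s r} → s ≤ r → r < m → A (suc m) (tri s) (diag r ∸ tri s)
block⇒A {m} {s} {r} s≤r r<m =
  s , r , s≤r , subst (_≤ suc m) (+-comm 2 r) (s≤s r<m) , sym (t≡tri s) , sym (t-diag s r)

A-subset : ∀ m i j → A (suc m) i j → T (tri m) i j
A-subset m i j p with A⇒block p
... | s , r , s≤r , r<m , refl , refl = <-≤-trans (block-point< s≤r) (tri-mono r<m)

A-injective : ∀ m (a b : ST (tri m)) → (∀ i j → A (suc m) i j → entry a i j ≡ entry b i j) → a ≈ST b
A-injective m a b agree i j i+j<N = begin
  entry a i j                ≡⟨ entry≡steinhaus a i j i+j<N ⟩
  steinhaus (entry a 0) i j  ≡⟨ steinhaus-local rows-agree i j i+j<N ⟩
  steinhaus (entry b 0) i j  ≡⟨ sym (entry≡steinhaus b i j i+j<N) ⟩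
  entry b i j                ∎
  where
  a₀ b₀ : ℕ → Bool
  a₀ = entry a 0
  b₀ = entry b 0
  difference-vanishes : ∀ r → r < m → ∀ s → s ≤ r → blockEntry (λ k → a₀ k xor b₀ k) r s ≡ false
  difference-vanishes r r<m s s≤r = begin
    steinhaus (λ k → a₀ k xor b₀ k) i' j'      ≡⟨ steinhaus-xor a₀ b₀ i' j' ⟩
    steinhaus a₀ i' j' xor steinhaus b₀ i' j'  ≡⟨ cong₂ _xor_ (sym (entry≡steinhaus a i' j' i'+j'<N))
                                                              (sym (entry≡steinhaus b i' j' i'+j'<N)) ⟩
    entry a i' j' xor entry b i' j'            ≡⟨ cong (entry a i' j' xor_) (sym (agree i' j' p)) ⟩
    entry a i' j' xor entry a i' j'            ≡⟨ xor-same (entry a i' j') ⟩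
    false                                      ∎
    where
    i' j' : ℕ
    i' = tri s
    j' = diag r ∸ tri s
    p : A (suc m) i' j'
    p = block⇒A s≤r r<m
    i'+j'<N : i' + j' < tri m
    i'+j'<N = A-subset m i' j' p
  rows-agree : ∀ k → k < tri m → a₀ k ≡ b₀ k
  rows-agree k k<N = xor≡false⇒≡ (rows-vanishing m _ difference-vanishes k k<N)

A-surjective : ∀ m (f : ℕ → ℕ → Bool) → ∃[ a ] (∀ i j → A (suc m) i j → entry {tri m} a i j ≡ f i j)
A-surjective m f with rows-realising m f
... | x , x-at = steinhaus-ST x , realised
  where
  realised : ∀ i j → A (suc m) i j → steinhaus x i j ≡ f i j
  realised i j p with A⇒block p
  ... | s , r , s≤r , r<m , refl , refl = x-at r r<m s s≤r

theorem2 : (n : ℕ) → 1 ≤ n → IsGeneratingIndexSet (t (n ∸ 1)) (A n)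
theorem2 (suc m) _ = subst (λ N → IsGeneratingIndexSet N (A (suc m))) (sym (t≡tri m)) record
  { subset     = A-subset m
  ; injective  = A-injective m
  ; surjective = A-surjective m
  }
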